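{- Let $r,n$ be positive integers with $r\leq n$, and let $\mathbf{s}=(s_1,\ldots,s_r)$ and $\mathbf{t}=(t_1,\ldots,t_r)$ be $r$-tuples of positive integers such that $s_1+\cdots+s_r\geq t_1+\cdots+t_r$ and there is some $0\leq l\leq r-1$ with $s_i\leq t_i$ for $1\leq i\leq l$ and $s_i\geq t_i$ for $l+1\leq i\leq r$. Then $\overline{H}_n(s_1,\ldots,s_r)\leq \overline{H}_n(t_1,\ldots,t_r)$.
   Context: For positive integers $r\le n$ and positive integers $u_1,\dots,u_r$, $\overline{H}_n(u_1,\ldots,u_r)=\sum_{0\leq k_1<\cdots<k_r\leq n-1}\prod_{j=1}^{r}(2k_j+1)^{ -u_j}$. -}

module Defs where

open import Data.Nat using (ℕ; zero; suc; _∸_; _*_; _^_)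
open import Data.Nat.Properties using (m^n≢0)
open import Data.Integer using (+_)
open import Data.Rational using (ℚ; _/_; _+_; 0ℚ; 1ℚ) renaming (_*_ to _*ℚ_)
open import Data.Vec using (Vec; []; _∷_)

oddInvPow : ℕ → ℕ → ℚ
oddInvPow k u = _/_ (+ 1) (suc (2 * k) ^ u) {{m^n≢0 (suc (2 * k)) u}}

sumFrom : ℕ → ℕ → (ℕ → ℚ) → ℚ
sumFrom a zero    f = 0ℚ
sumFrom a (suc c) f = f a + sumFrom (suc a) c f

-- Hfrom a n (u₁,…,u_r) = Σ_{a ≤ k₁ < ⋯ < k_r ≤ n-1} Π_j (2k_j+1)^(-u_j)
Hfrom : ℕ → ℕ → {r : ℕ} → Vec ℕ r → ℚ
Hfrom a n []       = 1ℚ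
Hfrom a n (u ∷ us) = sumFrom a (n ∸ a) (λ k → oddInvPow k u *ℚ Hfrom (suc k) n us)

Hbar : ℕ → {r : ℕ} → Vec ℕ r → ℚ
Hbar n us = Hfrom 0 n us

-- For indices k₁ < ⋯ < k_r the ratio of the corresponding terms of H̄_n(s)
-- and H̄_n(t) is Π_j (2k_j+1)^(t_j − s_j), and it is at most 1. Scanning j
-- upward, the partial ratio is bounded by (2a+1)^D, where D is the excess of
-- t over s accumulated so far (truncated at 0) and a is any lower bound of the
-- remaining indices: a positive exponent raises D, a negative one uses it up.
-- Since every suffix sum of t is at most that of s, the final excess is 0.
module Submission where

open import Defs
open import Data.Nat using (ℕ; _≤_; _<_)
open import Data.Fin using (Fin; toℕ)
open import Data.Vec using (Vec; lookup; sum)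
open import Data.Product using (Σ; _×_)
open import Data.Rational using () renaming (_≤_ to _≤ℚ_)

open import Data.Nat as ℕ using (zero; suc; z≤n; s≤s; _+_; _∸_; _^_; NonZero)
import Data.Nat.Properties as ℕ
open import Data.Fin using () renaming (zero to fzero; suc to fsuc)
open import Data.Vec using ([]; _∷_)
open import Data.Product using (_,_; proj₁; proj₂)
open import Data.Sum using (inj₁; inj₂)
open import Data.Integer as ℤ using (+_)
import Data.Integer.Properties as ℤ
open import Data.Rational as ℚ using (ℚ; 0ℚ; 1ℚ; _/_; _*_)
import Data.Rational.Properties as ℚ
import Data.Rational.Unnormalised as ℚᵘ
import Data.Rational.Unnormalised.Properties as ℚᵘ
import Data.Nat.Coprimality as Coprimality
open import Relation.Binary.PropositionalEquality

odd : ℕ → ℕ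
odd k = suc (2 ℕ.* k)

odd-mono-≤ : ∀ {j k} → j ≤ k → odd j ≤ odd k
odd-mono-≤ j≤k = s≤s (ℕ.*-monoʳ-≤ 2 j≤k)

-- x ≤ y ≤ z stand for 2a+1 ≤ 2k+1 ≤ 2k+3.
excess-transfer : ∀ {x y z} .{{_ : NonZero y}} D u v → x ≤ y → y ≤ z →
                  x ^ D ℕ.* y ^ v ≤ y ^ u ℕ.* z ^ ((D + v) ∸ u)
excess-transfer {x} {y} {z} D u v x≤y y≤z = begin
  x ^ D ℕ.* y ^ v           ≤⟨ ℕ.*-monoˡ-≤ (y ^ v) (ℕ.^-monoˡ-≤ D x≤y) ⟩
  y ^ D ℕ.* y ^ v           ≡⟨ ℕ.^-distribˡ-+-* y D v ⟨
  y ^ (D + v)               ≤⟨ ℕ.^-monoʳ-≤ y (ℕ.m≤n+m∸n (D + v) u) ⟩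
  y ^ (u + (D + v ∸ u))     ≡⟨ ℕ.^-distribˡ-+-* y u (D + v ∸ u) ⟩
  y ^ u ℕ.* y ^ (D + v ∸ u) ≤⟨ ℕ.*-monoʳ-≤ (y ^ u) (ℕ.^-monoˡ-≤ (D + v ∸ u) y≤z) ⟩
  y ^ u ℕ.* z ^ (D + v ∸ u) ∎
  where open ℕ.≤-Reasoning

excess-∸-+-≤ : ∀ x u {S T} → x + T ≤ u + S → T ≤ S → (x ∸ u) + T ≤ S
excess-∸-+-≤ x u {S} {T} x+T≤u+S T≤S with ℕ.≤-total x u
... | inj₁ x≤u rewrite ℕ.m≤n⇒m∸n≡0 x≤u = T≤S
... | inj₂ u≤x = begin
  (x ∸ u) + T ≡⟨ ℕ.+-∸-comm T u≤x ⟨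
  (x + T) ∸ u ≤⟨ ℕ.∸-monoˡ-≤ u x+T≤u+S ⟩
  (u + S) ∸ u ≡⟨ ℕ.m+n∸m≡n u S ⟩
  S           ∎
  where open ℕ.≤-Reasoning

ι : ℕ → ℚ
ι m = ℚ.mkℚ (+ m) 0 (Coprimality.sym (Coprimality.1-coprimeTo m))

ι-*-1/-≤ : ∀ {m m′} A B .{{_ : NonZero A}} .{{_ : NonZero B}} →
           m ℕ.* B ≤ A ℕ.* m′ → ι m * (+ 1 / A) ≤ℚ (+ 1 / B) * ι m′
ι-*-1/-≤ {m} {m′} (suc a) (suc b) mB≤Am′ = ℚ.toℚᵘ-cancel-≤ (begin
  ℚ.toℚᵘ (ι m * (+ 1 / suc a))
    ≃⟨ ℚ.toℚᵘ-homo-* (ι m) (+ 1 / suc a) ⟩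
  ℚ.toℚᵘ (ι m) ℚᵘ.* ℚ.toℚᵘ (+ 1 / suc a)
    ≃⟨ ℚᵘ.*-cong ℚᵘ.≃-refl (ℚ.toℚᵘ-fromℚᵘ (ℚᵘ.mkℚᵘ (+ 1) a)) ⟩
  ℚᵘ.mkℚᵘ (+ m) 0 ℚᵘ.* ℚᵘ.mkℚᵘ (+ 1) a
    ≤⟨ ℚᵘ.*≤* cross-multiplied ⟩
  ℚᵘ.mkℚᵘ (+ 1) b ℚᵘ.* ℚᵘ.mkℚᵘ (+ m′) 0
    ≃⟨ ℚᵘ.*-cong (ℚ.toℚᵘ-fromℚᵘ (ℚᵘ.mkℚᵘ (+ 1) b)) ℚᵘ.≃-refl ⟨
  ℚ.toℚᵘ (+ 1 / suc b) ℚᵘ.* ℚ.toℚᵘ (ι m′)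
    ≃⟨ ℚ.toℚᵘ-homo-* (+ 1 / suc b) (ι m′) ⟨
  ℚ.toℚᵘ ((+ 1 / suc b) * ι m′) ∎)
  where
  open ℚᵘ.≤-Reasoning
  cross-multiplied : (+ m ℤ.* + 1) ℤ.* + (suc b ℕ.* 1) ℤ.≤ (+ 1 ℤ.* + m′) ℤ.* + (1 ℕ.* suc a)
  cross-multiplied
    rewrite ℤ.*-identityʳ (+ m) | ℤ.*-identityˡ (+ m′)
          | ℕ.*-identityʳ (suc b) | ℕ.*-identityˡ (suc a)
          | sym (ℤ.pos-* m (suc b)) | sym (ℤ.pos-* m′ (suc a))
          | ℕ.*-comm m′ (suc a)
          = ℤ.+≤+ mB≤Am′

*-*-mono-≤ : ∀ {m p q m′ h h′} → 0ℚ ≤ℚ q → 0ℚ ≤ℚ h →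
             m * p ≤ℚ q * m′ → m′ * h ≤ℚ h′ → m * (p * h) ≤ℚ q * h′
*-*-mono-≤ {m} {p} {q} {m′} {h} {h′} 0≤q 0≤h mp≤qm′ m′h≤h′ = begin
  m * (p * h)  ≡⟨ ℚ.*-assoc m p h ⟨
  (m * p) * h  ≤⟨ ℚ.*-monoʳ-≤-nonNeg h {{ℚ.nonNegative 0≤h}} mp≤qm′ ⟩
  (q * m′) * h ≡⟨ ℚ.*-assoc q m′ h ⟩
  q * (m′ * h) ≤⟨ ℚ.*-monoˡ-≤-nonNeg q {{ℚ.nonNegative 0≤q}} m′h≤h′ ⟩
  q * h′       ∎
  where open ℚ.≤-Reasoning

0≤*0≤⇒0≤ : ∀ {p q} → 0ℚ ≤ℚ p → 0ℚ ≤ℚ q → 0ℚ ≤ℚ p * q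
0≤*0≤⇒0≤ {p} {q} 0≤p 0≤q = ℚ.nonNegative⁻¹ (p * q)
  {{ℚ.nonNeg*nonNeg⇒nonNeg p {{ℚ.nonNegative 0≤p}} q {{ℚ.nonNegative 0≤q}}}}

sumFrom-*-distribˡ : ∀ x a c (f : ℕ → ℚ) →
                     x * sumFrom a c f ≡ sumFrom a c (λ k → x * f k)
sumFrom-*-distribˡ x a zero    f = ℚ.*-zeroʳ x
sumFrom-*-distribˡ x a (suc c) f = begin
  x * (f a ℚ.+ sumFrom (suc a) c f)             ≡⟨ ℚ.*-distribˡ-+ x (f a) _ ⟩
  x * f a ℚ.+ x * sumFrom (suc a) c f           ≡⟨ cong (x * f a ℚ.+_) (sumFrom-*-distribˡ x (suc a) c f) ⟩
  x * f a ℚ.+ sumFrom (suc a) c (λ k → x * f k) ∎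
  where open ≡-Reasoning

sumFrom-mono-≤ : ∀ a c {f g : ℕ → ℚ} → (∀ k → a ≤ k → f k ≤ℚ g k) →
                 sumFrom a c f ≤ℚ sumFrom a c g
sumFrom-mono-≤ a zero    f≤g = ℚ.≤-refl
sumFrom-mono-≤ a (suc c) f≤g =
  ℚ.+-mono-≤ (f≤g a ℕ.≤-refl) (sumFrom-mono-≤ (suc a) c λ k a<k → f≤g k (ℕ.<⇒≤ a<k))

sumFrom-nonNeg : ∀ a c {f : ℕ → ℚ} → (∀ k → 0ℚ ≤ℚ f k) → 0ℚ ≤ℚ sumFrom a c f
sumFrom-nonNeg a zero    0≤f = ℚ.≤-refl
sumFrom-nonNeg a (suc c) 0≤f = ℚ.+-mono-≤ (0≤f a) (sumFrom-nonNeg (suc a) c 0≤f)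

oddInvPow-nonNeg : ∀ k u → 0ℚ ≤ℚ oddInvPow k u
oddInvPow-nonNeg k u = ℚ.nonNegative⁻¹ (oddInvPow k u)
  {{ℚ.normalize-nonNeg 1 (odd k ^ u) {{ℕ.m^n≢0 (odd k) u}}}}

Hfrom-nonNeg : ∀ a n {r} (us : Vec ℕ r) → 0ℚ ≤ℚ Hfrom a n us
Hfrom-nonNeg a n []       = ℚ.nonNegative⁻¹ 1ℚ
Hfrom-nonNeg a n (u ∷ us) = sumFrom-nonNeg a (n ∸ a) λ k →
  0≤*0≤⇒0≤ (oddInvPow-nonNeg k u) (Hfrom-nonNeg (suc k) n us)

data SuffixSums≤ : ∀ {r} → Vec ℕ r → Vec ℕ r → Set where
  []  : SuffixSums≤ [] []
  _∷_ : ∀ {r u v} {us vs : Vec ℕ r} →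
        sum (v ∷ vs) ≤ sum (u ∷ us) → SuffixSums≤ vs us → SuffixSums≤ (v ∷ vs) (u ∷ us)

SuffixSums≤⇒sum≤ : ∀ {r} {t s : Vec ℕ r} → SuffixSums≤ t s → sum t ≤ sum s
SuffixSums≤⇒sum≤ []        = z≤n
SuffixSums≤⇒sum≤ (t≤s ∷ _) = t≤s

module _ (n : ℕ) where

  weighted-Hfrom-≤ : ∀ a D {r} (s t : Vec ℕ r) → D + sum t ≤ sum s → SuffixSums≤ t s →
                     ι (odd a ^ D) * Hfrom a n s ≤ℚ Hfrom a n t
  weighted-Hfrom-≤ a D [] [] D+0≤0 [] rewrite ℕ.n≤0⇒n≡0 (ℕ.m+n≤o⇒m≤o D D+0≤0) = ℚ.≤-refl
  weighted-Hfrom-≤ a D (u ∷ us) (v ∷ vs) D+t≤s (_ ∷ vs≤us) = begin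
    ι (odd a ^ D) * sumFrom a (n ∸ a) (λ k → oddInvPow k u * Hfrom (suc k) n us)
      ≡⟨ sumFrom-*-distribˡ (ι (odd a ^ D)) a (n ∸ a) _ ⟩
    sumFrom a (n ∸ a) (λ k → ι (odd a ^ D) * (oddInvPow k u * Hfrom (suc k) n us))
      ≤⟨ sumFrom-mono-≤ a (n ∸ a) term-≤ ⟩
    sumFrom a (n ∸ a) (λ k → oddInvPow k v * Hfrom (suc k) n vs) ∎
    where
    open ℚ.≤-Reasoning
    D′ : ℕ
    D′ = (D + v) ∸ u
    D′+vs≤us : D′ + sum vs ≤ sum us
    D′+vs≤us = excess-∸-+-≤ (D + v) u
                 (subst (_≤ u + sum us) (sym (ℕ.+-assoc D v (sum vs))) D+t≤s)
                 (SuffixSums≤⇒sum≤ vs≤us)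
    term-≤ : ∀ k → a ≤ k → ι (odd a ^ D) * (oddInvPow k u * Hfrom (suc k) n us)
                             ≤ℚ oddInvPow k v * Hfrom (suc k) n vs
    term-≤ k a≤k =
      *-*-mono-≤ {ι (odd a ^ D)} {oddInvPow k u} (oddInvPow-nonNeg k v) (Hfrom-nonNeg (suc k) n us)
        (ι-*-1/-≤ (odd k ^ u) (odd k ^ v) {{ℕ.m^n≢0 (odd k) u}} {{ℕ.m^n≢0 (odd k) v}}
          (excess-transfer D u v (odd-mono-≤ a≤k) (odd-mono-≤ (ℕ.n≤1+n k))))
        (weighted-Hfrom-≤ (suc k) D′ us vs D′+vs≤us vs≤us)

SwitchesAt : ∀ {r} → ℕ → Vec ℕ r → Vec ℕ r → Set
SwitchesAt {r} l s t = (i : Fin r) → (toℕ i < l → lookup s i ≤ lookup t i)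
                                    × (l ≤ toℕ i → lookup t i ≤ lookup s i)

Pointwise≥⇒SuffixSums≤ : ∀ {r} (s t : Vec ℕ r) → (∀ i → lookup t i ≤ lookup s i) → SuffixSums≤ t s
Pointwise≥⇒SuffixSums≤ []       []       t≤s = []
Pointwise≥⇒SuffixSums≤ (u ∷ us) (v ∷ vs) t≤s =
  ℕ.+-mono-≤ (t≤s fzero) (SuffixSums≤⇒sum≤ tail) ∷ tail
  where tail = Pointwise≥⇒SuffixSums≤ us vs (λ i → t≤s (fsuc i))

SwitchesAt⇒SuffixSums≤ : ∀ l {r} (s t : Vec ℕ r) → SwitchesAt l s t → sum t ≤ sum s →
                         SuffixSums≤ t s
SwitchesAt⇒SuffixSums≤ zero    s        t        switch t≤s =
  Pointwise≥⇒SuffixSums≤ s t (λ i → proj₂ (switch i) z≤n)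
SwitchesAt⇒SuffixSums≤ (suc l) []       []       switch t≤s = []
SwitchesAt⇒SuffixSums≤ (suc l) (u ∷ us) (v ∷ vs) switch t≤s =
  t≤s ∷ SwitchesAt⇒SuffixSums≤ l us vs switch′ vs≤us
  where
  switch′ : SwitchesAt l us vs
  switch′ i = (λ i<l → proj₁ (switch (fsuc i)) (s≤s i<l))
            , (λ l≤i → proj₂ (switch (fsuc i)) (s≤s l≤i))
  vs≤us : sum vs ≤ sum us
  vs≤us = ℕ.+-cancelˡ-≤ u (sum vs) (sum us)
            (ℕ.≤-trans (ℕ.+-monoˡ-≤ (sum vs) (proj₁ (switch fzero) (s≤s z≤n))) t≤s)

lemma2p2 : (r n : ℕ) → 1 ≤ r → r ≤ n → (s t : Vec ℕ r) →
           (∀ i → 1 ≤ lookup s i) → (∀ i → 1 ≤ lookup t i) →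
           sum t ≤ sum s →
           Σ ℕ (λ l → l < r × ((i : Fin r) → (toℕ i < l → lookup s i ≤ lookup t i)
                                            × (l ≤ toℕ i → lookup t i ≤ lookup s i))) →
           Hbar n s ≤ℚ Hbar n t
lemma2p2 r n _ _ s t _ _ t≤s (l , _ , switch) =
  subst (_≤ℚ Hbar n t) (ℚ.*-identityˡ (Hbar n s))
    (weighted-Hfrom-≤ n 0 0 s t t≤s (SwitchesAt⇒SuffixSums≤ l s t switch t≤s))
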